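{- Let $A^n$ ($n>2$) be an apic graph. Then $\pi_{fl}(A^n)\le 8$.
   Context: An apic graph $A^n$, $n>2$, is a plane graph on $2n$ vertices with $2(n-1)$ triangular faces and one $2n$-gonal face, obtained from the ladder graph $L_n=P_n\square P_2$ (standard plane embedding) by adding one diagonal edge inside each quadrangular face so that no vertex of the resulting graph has degree greater than 4. A sequence $r_1\dots r_{2n}$ is a repetition if $r_i=r_{n+i}$ for all $i\le n$. In a plane graph $G$, a facial path is a path whose vertices and edges are consecutive on the boundary walk of some face of $G$. A vertex colouring is facial non-repetitive if no facial path on vertices $v_1,\dots,v_{2n}$ ($n\ge1$) has colour sequence that is a repetition. $\pi_{fl}(G)$ is the minimum $l$ such that for every assignment of lists $L(v)\subseteq\mathbb{Z}_+$ with $|L(v)|\ge l$ there is a facial non-repetitive colouring $\varphi$ with $\varphi(v)\in L(v)$ for every vertex $v$. -}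

module Defs where

open import Data.Bool using (Bool; true; false; if_then_else_)
open import Data.Nat using (ℕ; suc; _+_; _≤_; _<_)
open import Data.Fin using (Fin; inject₁) renaming (suc to fsuc)
import Data.Fin.Properties as FinP
import Data.Bool.Properties as BoolP
open import Data.Product using (_×_; _,_; proj₁; proj₂; ∃; ∃-syntax)
open import Data.Product.Properties using (≡-dec)
open import Data.Sum using (_⊎_)
open import Data.List using (List; []; _∷_; map; _++_; reverse; take; drop; length; filter; concatMap; allFin)
open import Data.List.Membership.Propositional using (_∈_)
open import Relation.Binary.PropositionalEquality using (_≡_)
open import Relation.Nullary using (¬_)
open import Relation.Nullary.Decidable using (_⊎-dec_)
open import Relation.Binary using (DecidableEquality)

-- Apic graph A^n with n = suc m vertices per side.
-- Vertices: (false , i) = u_i (top row), (true , i) = w_i (bottom row), i < n.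
V : ℕ → Set
V m = Bool × Fin (suc m)

_≟V_ : ∀ {m} → DecidableEquality (V m)
_≟V_ = ≡-dec BoolP._≟_ FinP._≟_

top bot : ∀ {m} → Fin (suc m) → V m
top i = (false , i)
bot i = (true , i)

-- A choice of diagonal for each of the m quadrangular faces of the ladder L_n.
-- Quad i has corners u_i, u_{i+1}, w_{i+1}, w_i.
-- d i = false : diagonal u_i w_{i+1};  d i = true : diagonal u_{i+1} w_i.
Diagonals : ℕ → Set
Diagonals m = Fin m → Bool

Edge : ℕ → Set
Edge m = V m × V m

diagEdge : ∀ {m} → Diagonals m → Fin m → Edge m
diagEdge d i = if d i then (top (fsuc i) , bot (inject₁ i)) else (top (inject₁ i) , bot (fsuc i))

edges : ∀ {m} → Diagonals m → List (Edge m)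
edges {m} d =
  map (λ i → (top (inject₁ i) , top (fsuc i))) (allFin m)
  ++ map (λ i → (bot (inject₁ i) , bot (fsuc i))) (allFin m)
  ++ map (λ i → (top i , bot i)) (allFin (suc m))
  ++ map (diagEdge d) (allFin m)

degree : ∀ {m} → Diagonals m → V m → ℕ
degree d v = length (filter (λ e → (v ≟V proj₁ e) ⊎-dec (v ≟V proj₂ e)) (edges d))

IsApic : ∀ {m} → Diagonals m → Set
IsApic {m} d = ∀ (v : V m) → degree d v ≤ 4

-- Faces of the plane embedding, each given by its (cyclic) boundary walk.
triangles : ∀ {m} → Diagonals m → Fin m → List (List (V m))
triangles d i =
  if d i
  then (top a ∷ top b ∷ bot a ∷ []) ∷ (top b ∷ bot b ∷ bot a ∷ []) ∷ []
  else (top a ∷ top b ∷ bot b ∷ []) ∷ (top a ∷ bot b ∷ bot a ∷ []) ∷ []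
  where
  a = inject₁ i
  b = fsuc i

outerFace : ∀ m → List (V m)
outerFace m = map top (allFin (suc m)) ++ reverse (map bot (allFin (suc m)))

faces : ∀ {m} → Diagonals m → List (List (V m))
faces {m} d = outerFace m ∷ concatMap (triangles d) (allFin m)

-- A facial path: l consecutive vertices (1 ≤ l ≤ length of the face) along the
-- boundary cycle of some face, starting at position s, in either direction.
-- (All face boundaries here are cycles, so these vertices are distinct.)
IsFacialPath : ∀ {m} → Diagonals m → List (V m) → Set
IsFacialPath d p =
  ∃[ F ] (F ∈ faces d × ∃[ r ] ((r ≡ F ⊎ r ≡ reverse F) ×
    ∃[ s ] (s < length F × ∃[ l ] (1 ≤ l × l ≤ length F ×
      p ≡ take l (drop s r ++ take s r)))))

IsRepetition : List ℕ → Set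
IsRepetition c = ∃[ k ] (1 ≤ k × length c ≡ k + k × take k c ≡ drop k c)

FacialNonRepetitive : ∀ {m} → Diagonals m → (V m → ℕ) → Set
FacialNonRepetitive d φ = ∀ p → IsFacialPath d p → ¬ IsRepetition (map φ p)

-- Colour u₀ with some c ∈ L(u₀) and delete c from every other list, leaving at least 7 colours.
-- The rest of the outer face, u₁ … u_{n-1} w_{n-1} … w₀, is a path Q. Colour Q square-free from
-- these lists so that, in addition, each uᵢ differs from w_{i-1}, wᵢ, w_{i+1}; these are at most
-- 3 constraints, all towards later vertices of Q. Such colourings exist by a counting argument
-- in the style of Rosenfeld: building them from the end of Q, each new vertex at least doubles
-- their number n. Of the 7n one-letter extensions at most 3n use a forbidden colour, and at most 2n
-- begin with a square: such a word is determined by what follows the first half of the square,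
-- a colouring of a shorter suffix, and (as an invariant of the induction) all colourings of
-- shorter suffixes together number at most 2n.
-- Then the outer face is a cycle whose colour word is c followed by a square-free word avoiding c,
-- so none of its facial paths is a repetition. Every triangle is bounded by edges uᵢu_{i+1},
-- wᵢw_{i+1} (consecutive on the outer face) and uᵢwⱼ with |i - j| ≤ 1, so its three colours are
-- distinct, and a word with distinct letters is never a repetition.

module Submission where

open import Defs
open import Data.Bool using (true; false)
open import Data.Nat using (ℕ; zero; suc; _+_; _*_; _≤_; _<_; z≤n; s≤s; s≤s⁻¹)
open import Data.Nat.Properties hiding (_≟_)
import Data.Nat.Properties as ℕ
open import Data.Nat.ListAction using (sum)
open import Data.Nat.Tactic.RingSolver using (solve-∀)
open import Data.Fin using (Fin; inject₁; fromℕ<) renaming (zero to fzero; suc to fsuc)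
open import Data.Product using (_×_; _,_; proj₁; proj₂; ∃-syntax)
open import Data.Sum using (_⊎_; inj₁; inj₂; [_,_]′)
open import Data.Empty using (⊥; ⊥-elim)
open import Function using (id; _∘_)
open import Data.List
  using (List; []; _∷_; _++_; [_]; length; map; concat; take; drop; reverse; filter; lookup; tabulate; allFin;
         cartesianProductWith; applyUpTo)
open import Data.List.Properties
  using (length-++; length-map; length-reverse; ++-assoc; ++-identityʳ; ∷-injective; ∷-injectiveʳ;
         take++drop≡id; take-map; drop-map; map-++; map-applyUpTo; map-cong-local; reverse-++;
         reverse-involutive; reverse-map; unfold-reverse; ≡-dec)
open import Data.List.Membership.Propositional using (_∈_; _∉_; find)
open import Data.List.Membership.Propositional.Properties
  using (∈-∃++; ∈-++⁻; ∈-++⁺ˡ; ∈-++⁺ʳ; ∈-map⁺; ∈-map⁻; ∈-filter⁺; ∈-filter⁻;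
         ∈-cartesianProductWith⁺; ∈-cartesianProductWith⁻; ∈-concat⁺′; ∈-concatMap⁻; ∈-applyUpTo⁺;
         ∈-lookup; ∈-tabulate⁺; ∈-allFin)
import Data.List.Membership.DecPropositional as DecMembership
open import Data.List.Relation.Unary.Any using (here; there)
open import Data.List.Relation.Unary.Any.Properties using (reverse⁺; reverse⁻)
open import Data.List.Relation.Unary.All as All using (All)
open import Data.List.Relation.Unary.AllPairs as AllPairs using (_∷_)
open import Data.List.Relation.Unary.Unique.Propositional using (Unique)
import Data.List.Relation.Unary.Unique.Propositional.Properties as Unique
open import Data.List.Relation.Binary.Permutation.Propositional using (_↭_; ↭-sym; ↭-trans; ↭-reflexive; ↭⇒↭ₛ)
open import Data.List.Relation.Binary.Permutation.Propositional.Properties using (++-comm; ↭-reverse)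
import Data.List.Relation.Binary.Permutation.Setoid.Properties as Permutationₛ
open import Relation.Binary using (DecidableEquality)
open import Relation.Binary.PropositionalEquality hiding ([_])
open import Relation.Nullary using (¬_; yes; no; ¬?; _×-dec_)
open import Relation.Unary using (Decidable)

-- Counting lists

module _ {A : Set} where

  ∈-++-∷⁻ : ∀ (xs : List A) {a z ys} → z ∈ xs ++ a ∷ ys → z ≢ a → z ∈ xs ++ ys
  ∈-++-∷⁻ xs z∈ z≢a with ∈-++⁻ xs z∈
  ... | inj₁ z∈xs = ∈-++⁺ˡ z∈xs
  ... | inj₂ (here z≡a) = ⊥-elim (z≢a z≡a)
  ... | inj₂ (there z∈ys) = ∈-++⁺ʳ xs z∈ys

module _ {A B : Set} where

  length-≤-injection : ∀ (f : A → B) {xs ys} → Unique xs →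
    (∀ {x y} → x ∈ xs → y ∈ xs → f x ≡ f y → x ≡ y) → (∀ {x} → x ∈ xs → f x ∈ ys) →
    length xs ≤ length ys
  length-≤-injection f {[]} _ _ _ = z≤n
  length-≤-injection f {x ∷ xs} {ys} (x≢xs ∷ xs-unique) f-inj f-into
    with pre , post , refl ← ∈-∃++ (f-into (here refl)) =
    begin
      suc (length xs)              ≤⟨ s≤s (length-≤-injection f xs-unique
                                        (λ p q → f-inj (there p) (there q)) f-into′) ⟩
      suc (length (pre ++ post))   ≡⟨ cong suc (length-++ pre) ⟩
      suc (length pre + length post) ≡⟨ +-suc (length pre) (length post) ⟨
      length pre + length (f x ∷ post) ≡⟨ length-++ pre ⟨
      length (pre ++ f x ∷ post)   ∎
    where
    open ≤-Reasoning
    f-into′ : ∀ {y} → y ∈ xs → f y ∈ pre ++ post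
    f-into′ y∈xs = ∈-++-∷⁻ pre (f-into (there y∈xs))
      (λ fy≡fx → All.lookup x≢xs y∈xs (sym (f-inj (there y∈xs) (here refl) fy≡fx)))

module _ {A : Set} where

  length-≤-⊆ : ∀ {xs ys : List A} → Unique xs → (∀ {x} → x ∈ xs → x ∈ ys) → length xs ≤ length ys
  length-≤-⊆ xs-unique = length-≤-injection id xs-unique (λ _ _ → id)

module _ {A B C : Set} where

  length-cartesianProductWith : ∀ (f : A → B → C) xs ys →
    length (cartesianProductWith f xs ys) ≡ length xs * length ys
  length-cartesianProductWith f [] ys = refl
  length-cartesianProductWith f (x ∷ xs) ys = begin
    length (map (f x) ys ++ cartesianProductWith f xs ys)       ≡⟨ length-++ (map (f x) ys) ⟩
    length (map (f x) ys) + length (cartesianProductWith f xs ys)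
      ≡⟨ cong₂ _+_ (length-map (f x) ys) (length-cartesianProductWith f xs ys) ⟩
    length ys + length xs * length ys                             ∎
    where open ≡-Reasoning

length-concat : ∀ {A : Set} (xss : List (List A)) → length (concat xss) ≡ sum (map length xss)
length-concat [] = refl
length-concat (xs ∷ xss) = trans (length-++ xs) (cong (length xs +_) (length-concat xss))

sum-applyUpTo-mono : ∀ {f g : ℕ → ℕ} → (∀ j → f j ≤ g j) → ∀ n → sum (applyUpTo f n) ≤ sum (applyUpTo g n)
sum-applyUpTo-mono f≤g zero = z≤n
sum-applyUpTo-mono f≤g (suc n) = +-mono-≤ (f≤g 0) (sum-applyUpTo-mono (f≤g ∘ suc) n)

-- Square-free words and cycles

module _ {A : Set} where

  SquareFree : List A → Set
  SquareFree z = ∀ xs y ys → y ≢ [] → z ≢ xs ++ y ++ y ++ ys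

  -- z begins with a square of half-length k (for k ≥ 1 and z ≢ [] the takes only agree if 2k ≤ length z)
  SquarePrefix : ℕ → List A → Set
  SquarePrefix k z = take k z ≡ take k (drop k z)

  HasSquarePrefix : List A → Set
  HasSquarePrefix z = ∃[ j ] j < length z × SquarePrefix (suc j) z

  module _ (_≟_ : DecidableEquality A) where

    squarePrefix? : ∀ k → Decidable (SquarePrefix k)
    squarePrefix? k z = ≡-dec _≟_ (take k z) (take k (drop k z))

    hasSquarePrefix? : Decidable HasSquarePrefix
    hasSquarePrefix? z = anyUpTo? (λ j → squarePrefix? (suc j) z) (length z)

  take-length-++ : ∀ (xs ys : List A) → take (length xs) (xs ++ ys) ≡ xs
  take-length-++ [] ys = refl
  take-length-++ (x ∷ xs) ys = cong (x ∷_) (take-length-++ xs ys)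

  drop-length-++ : ∀ (xs ys : List A) → drop (length xs) (xs ++ ys) ≡ ys
  drop-length-++ [] ys = refl
  drop-length-++ (x ∷ xs) ys = drop-length-++ xs ys

  SquarePrefix-++ : ∀ (y ys : List A) → SquarePrefix (length y) (y ++ y ++ ys)
  SquarePrefix-++ y ys = begin
    take (length y) (y ++ y ++ ys)                        ≡⟨ take-length-++ y (y ++ ys) ⟩
    y                                                     ≡⟨ take-length-++ y ys ⟨
    take (length y) (y ++ ys)                             ≡⟨ cong (take (length y)) (drop-length-++ y (y ++ ys)) ⟨
    take (length y) (drop (length y) (y ++ y ++ ys))      ∎
    where open ≡-Reasoning

  SquarePrefix⇒≡ : ∀ k z → SquarePrefix k z → z ≡ take k (drop k z) ++ drop k z
  SquarePrefix⇒≡ k z sq = trans (sym (take++drop≡id k z)) (cong (_++ drop k z) sq)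

  squareFree-[] : SquareFree []
  squareFree-[] [] [] ys y≢[] _ = y≢[] refl
  squareFree-[] [] (_ ∷ _) ys _ ()

  squareFree-∷ : ∀ {c w} → SquareFree w → ¬ HasSquarePrefix (c ∷ w) → SquareFree (c ∷ w)
  squareFree-∷ sf ¬sq (_ ∷ xs) y ys y≢[] eq = sf xs y ys y≢[] (∷-injectiveʳ eq)
  squareFree-∷ sf ¬sq [] [] ys y≢[] eq = y≢[] refl
  squareFree-∷ {c} {w} sf ¬sq [] y@(_ ∷ y′) ys y≢[] eq =
    ¬sq (length y′ , y′<c∷w , subst (SquarePrefix (length y)) (sym eq) (SquarePrefix-++ y ys))
    where
    y′<c∷w : length y′ < length (c ∷ w)
    y′<c∷w = begin-strict
      length y′                 <⟨ n<1+n (length y′) ⟩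
      length y                  ≤⟨ m≤m+n (length y) (length (y ++ ys)) ⟩
      length y + length (y ++ ys) ≡⟨ length-++ y ⟨
      length (y ++ y ++ ys)     ≡⟨ cong length eq ⟨
      length (c ∷ w)            ∎
      where open ≤-Reasoning

  squareFree-drop : ∀ k {z} → SquareFree z → SquareFree (drop k z)
  squareFree-drop k {z} sf xs y ys y≢[] eq = sf (take k z ++ xs) y ys y≢[] (begin
    z                                  ≡⟨ take++drop≡id k z ⟨
    take k z ++ drop k z               ≡⟨ cong (take k z ++_) eq ⟩
    take k z ++ xs ++ y ++ y ++ ys     ≡⟨ ++-assoc (take k z) xs _ ⟨
    (take k z ++ xs) ++ y ++ y ++ ys   ∎)
    where open ≡-Reasoning

  squareFree-reverse : ∀ {z} → SquareFree z → SquareFree (reverse z)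
  squareFree-reverse {z} sf xs y ys y≢[] eq =
    sf (reverse ys) (reverse y) (reverse xs) (y≢[] ∘ reverse-[]) (begin
      z                                          ≡⟨ reverse-involutive z ⟨
      reverse (reverse z)                        ≡⟨ cong reverse eq ⟩
      reverse (xs ++ y ++ y ++ ys)               ≡⟨ reverse-++ xs _ ⟩
      reverse (y ++ y ++ ys) ++ reverse xs       ≡⟨ cong (_++ reverse xs) (reverse-++ y _) ⟩
      (reverse (y ++ ys) ++ reverse y) ++ reverse xs
        ≡⟨ cong (λ t → (t ++ reverse y) ++ reverse xs) (reverse-++ y ys) ⟩
      ((reverse ys ++ reverse y) ++ reverse y) ++ reverse xs
        ≡⟨ cong (_++ reverse xs) (++-assoc (reverse ys) (reverse y) (reverse y)) ⟩
      (reverse ys ++ reverse y ++ reverse y) ++ reverse xs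
        ≡⟨ ++-assoc (reverse ys) _ (reverse xs) ⟩
      reverse ys ++ (reverse y ++ reverse y) ++ reverse xs
        ≡⟨ cong (reverse ys ++_) (++-assoc (reverse y) (reverse y) (reverse xs)) ⟩
      reverse ys ++ reverse y ++ reverse y ++ reverse xs ∎)
    where
    open ≡-Reasoning
    reverse-[] : reverse y ≡ [] → y ≡ []
    reverse-[] eq′ = trans (sym (reverse-involutive y)) (cong reverse eq′)

  squareFree⇒≢ : ∀ {z} xs {a b} ys → SquareFree z → z ≡ xs ++ a ∷ b ∷ ys → a ≢ b
  squareFree⇒≢ xs ys sf eq refl = sf xs (_ ∷ []) ys (λ ()) eq

  ∉⇒prefix : ∀ {c : A} q {w} X {Y} → q ++ w ≡ X ++ c ∷ Y → c ∉ q → ∃[ v ] X ≡ q ++ v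
  ∉⇒prefix [] X eq c∉q = X , refl
  ∉⇒prefix (a ∷ q) [] eq c∉q with refl , _ ← ∷-injective eq = ⊥-elim (c∉q (here refl))
  ∉⇒prefix (a ∷ q) (b ∷ X) eq c∉q with refl , eq′ ← ∷-injective eq =
    let v , X≡ = ∉⇒prefix q X eq′ (c∉q ∘ there) in v , cong (a ∷_) X≡

  -- as c ∉ X, the displayed c is the first one, so it lies in y
  ∈⇒suffix : ∀ {c : A} y {w} X {Y} → y ++ w ≡ X ++ c ∷ Y → c ∉ X → c ∈ y → ∃[ v ] Y ≡ v ++ w
  ∈⇒suffix (a ∷ y) [] eq c∉X c∈y with refl , eq′ ← ∷-injective eq = y , sym eq′
  ∈⇒suffix (a ∷ y) (b ∷ X) eq c∉X (here refl) with refl , _ ← ∷-injective eq = ⊥-elim (c∉X (here refl))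
  ∈⇒suffix (a ∷ y) (b ∷ X) eq c∉X (there c∈y) with refl , eq′ ← ∷-injective eq =
    ∈⇒suffix y X eq′ (c∉X ∘ there) c∈y

  -- a square at the front of X ++ c ∷ Y either contains c twice or lies inside X
  square-around-unique : DecidableEquality A → ∀ {c X Y} y {R} → c ∉ X → c ∉ Y → SquareFree X →
    y ≢ [] → y ++ y ++ R ≢ X ++ c ∷ Y
  square-around-unique _≟_ {c} {X} y {R} c∉X c∉Y sfX y≢[] eq with DecMembership._∈?_ _≟_ c y
  ... | yes c∈y = let v , Y≡ = ∈⇒suffix y X eq c∉X c∈y in
    c∉Y (subst (c ∈_) (sym Y≡) (∈-++⁺ʳ v (∈-++⁺ˡ c∈y)))
  ... | no c∉y = let v , X≡ = ∉⇒prefix (y ++ y) X (trans (++-assoc y y R) eq) c∉y++y in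
    sfX [] y v y≢[] (trans X≡ (++-assoc y y v))
    where
    c∉y++y : c ∉ y ++ y
    c∉y++y = [ c∉y , c∉y ]′ ∘ ∈-++⁻ y

module _ {A : Set} where

  rotate : ℕ → List A → List A
  rotate s r = drop s r ++ take s r

  Unique-resp-↭ : ∀ {xs ys : List A} → xs ↭ ys → Unique xs → Unique ys
  Unique-resp-↭ p = Permutationₛ.Unique-resp-↭ (setoid A) (↭⇒↭ₛ p)

  rotate-↭ : ∀ s (r : List A) → rotate s r ↭ r
  rotate-↭ s r = ↭-trans (++-comm (drop s r) (take s r)) (↭-reflexive (take++drop≡id s r))

  ∉-take : ∀ k {c : A} {z} → c ∉ z → c ∉ take k z
  ∉-take k {z = z} c∉z = c∉z ∘ subst (_ ∈_) (take++drop≡id k z) ∘ ∈-++⁺ˡ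

  ∉-drop : ∀ k {c : A} {z} → c ∉ z → c ∉ drop k z
  ∉-drop k {z = z} c∉z = c∉z ∘ subst (_ ∈_) (take++drop≡id k z) ∘ ∈-++⁺ʳ (take k z)

  drop-++ˡ : ∀ k (xs ys : List A) → k ≤ length xs → drop k (xs ++ ys) ≡ drop k xs ++ ys
  drop-++ˡ zero xs ys _ = refl
  drop-++ˡ (suc k) (x ∷ xs) ys (s≤s k≤) = drop-++ˡ k xs ys k≤

  take-++ˡ : ∀ k (xs ys : List A) → k ≤ length xs → take k (xs ++ ys) ≡ take k xs
  take-++ˡ zero xs ys _ = refl
  take-++ˡ (suc k) (x ∷ xs) ys (s≤s k≤) = cong (x ∷_) (take-++ˡ k xs ys k≤)

module _ {A B : Set} (f : A → B) where

  map-rotate : ∀ l s r → map f (take l (rotate s r)) ≡ take l (rotate s (map f r))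
  map-rotate l s r = begin
    map f (take l (drop s r ++ take s r))          ≡⟨ take-map l _ ⟨
    take l (map f (drop s r ++ take s r))          ≡⟨ cong (take l) (map-++ f (drop s r) (take s r)) ⟩
    take l (map f (drop s r) ++ map f (take s r))  ≡⟨ cong₂ (λ p q → take l (p ++ q)) (drop-map s r) (take-map s r) ⟨
    take l (drop s (map f r) ++ take s (map f r))  ∎
    where open ≡-Reasoning

IsRepetition⇒square : ∀ {z} → IsRepetition z → ∃[ y ] y ≢ [] × z ≡ y ++ y
IsRepetition⇒square {z} (k , 1≤k , length≡ , take≡drop) = take k z , y≢[] , z≡
  where
  z≡ : z ≡ take k z ++ take k z
  z≡ = trans (sym (take++drop≡id k z)) (cong (take k z ++_) (sym take≡drop))
  y≢[] : take k z ≢ []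
  y≢[] y≡[] = n>0⇒n≢0 1≤k (m+n≡0⇒m≡0 k (trans (sym length≡) (cong length z≡[])))
    where
    z≡[] : z ≡ []
    z≡[] = trans z≡ (cong (λ y → y ++ y) y≡[])

prefixRepetition⇒square : ∀ l z → IsRepetition (take l z) → ∃[ y ] ∃[ R ] y ≢ [] × z ≡ y ++ y ++ R
prefixRepetition⇒square l z rep with y , y≢[] , take≡ ← IsRepetition⇒square rep =
  y , drop l z , y≢[] , (begin
    z                         ≡⟨ take++drop≡id l z ⟨
    take l z ++ drop l z      ≡⟨ cong (_++ drop l z) take≡ ⟩
    (y ++ y) ++ drop l z      ≡⟨ ++-assoc y y _ ⟩
    y ++ y ++ drop l z        ∎)
  where open ≡-Reasoning

Unique⇒¬IsRepetition : ∀ {z} → Unique z → ¬ IsRepetition z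
Unique⇒¬IsRepetition u rep with IsRepetition⇒square rep
... | [] , y≢[] , _ = y≢[] refl
... | a ∷ y , _ , refl = Unique.Unique[x∷xs]⇒x∉xs u (∈-++⁺ʳ y (here refl))

Unique⇒facialWalk-nonRepetitive : ∀ {V : Set} (φ : V → ℕ) {F r} → Unique (map φ F) →
  (r ≡ F ⊎ r ≡ reverse F) → ∀ s l → ¬ IsRepetition (map φ (take l (rotate s r)))
Unique⇒facialWalk-nonRepetitive φ {F} {r} u r≡ s l =
  Unique⇒¬IsRepetition (subst Unique (sym (map-rotate φ l s r))
    (Unique.take⁺ l (Unique-resp-↭ (↭-sym (rotate-↭ s (map φ r))) (unique-r r≡))))
  where
  unique-r : r ≡ F ⊎ r ≡ reverse F → Unique (map φ r)
  unique-r (inj₁ refl) = u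
  unique-r (inj₂ refl) = subst Unique (sym (reverse-map φ F)) (Unique-resp-↭ (↭-sym (↭-reverse (map φ F))) u)

-- the rotations of the cyclic word c ∷ V other than c ∷ V itself; rotations of reverse (c ∷ W)
-- have this shape with V = reverse W
cut-cycle-nonRepetitive : ∀ {c V} → c ∉ V → SquareFree V → ∀ t l →
  ¬ IsRepetition (take l (drop t V ++ c ∷ take t V))
cut-cycle-nonRepetitive c∉V sf t l rep with y , R , y≢[] , eq ← prefixRepetition⇒square l _ rep =
  square-around-unique ℕ._≟_ y (∉-drop t c∉V) (∉-take t c∉V) (squareFree-drop t sf) y≢[] (sym eq)

cycle-nonRepetitive : ∀ {c W} → c ∉ W → SquareFree W → ∀ s l → ¬ IsRepetition (take l (rotate s (c ∷ W)))
cycle-nonRepetitive {c} {W} c∉W sf zero l rep with y , R , y≢[] , eq ← prefixRepetition⇒square l _ rep =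
  square-around-unique ℕ._≟_ {X = []} y (λ ()) (c∉W ∘ subst (c ∈_) (++-identityʳ W)) squareFree-[] y≢[] (sym eq)
cycle-nonRepetitive c∉W sf (suc t) = cut-cycle-nonRepetitive c∉W sf t

reverse-cycle-nonRepetitive : ∀ {c W} → c ∉ W → SquareFree W → ∀ s l → s ≤ length W →
  ¬ IsRepetition (take l (rotate s (reverse (c ∷ W))))
reverse-cycle-nonRepetitive {c} {W} c∉W sf s l s≤ = subst (¬_ ∘ IsRepetition ∘ take l) (sym rotate≡)
  (cut-cycle-nonRepetitive (c∉W ∘ reverse⁻) (squareFree-reverse sf) s l)
  where
  s≤′ : s ≤ length (reverse W)
  s≤′ = subst (s ≤_) (sym (length-reverse W)) s≤
  rotate≡ : rotate s (reverse (c ∷ W)) ≡ drop s (reverse W) ++ c ∷ take s (reverse W)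
  rotate≡ = begin
    rotate s (reverse (c ∷ W))                                ≡⟨ cong (rotate s) (unfold-reverse c W) ⟩
    drop s (reverse W ++ [ c ]) ++ take s (reverse W ++ [ c ])
      ≡⟨ cong₂ _++_ (drop-++ˡ s _ _ s≤′) (take-++ˡ s _ _ s≤′) ⟩
    (drop s (reverse W) ++ [ c ]) ++ take s (reverse W)       ≡⟨ ++-assoc (drop s (reverse W)) _ _ ⟩
    drop s (reverse W) ++ c ∷ take s (reverse W)              ∎
    where open ≡-Reasoning

-- Square-free list colourings of a path with conflicts

module ConstrainedListColouring {V : Set} (_≟_ : DecidableEquality V)
  (L : V → List ℕ) (conflicts : V → List V) where

  -- the colour of u in the word w read along vs (junk 0 if u ∉ vs)
  colourOf : V → List V → List ℕ → ℕ
  colourOf u (v ∷ vs) (c ∷ w) with u ≟ v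
  ... | yes _ = c
  ... | no _ = colourOf u vs w
  colourOf _ _ _ = 0

  colourOf-here : ∀ v vs c w → colourOf v (v ∷ vs) (c ∷ w) ≡ c
  colourOf-here v vs c w with v ≟ v
  ... | yes _ = refl
  ... | no v≢v = ⊥-elim (v≢v refl)

  colourOf-there : ∀ {u v} vs c w → v ≢ u → colourOf u (v ∷ vs) (c ∷ w) ≡ colourOf u vs w
  colourOf-there {u} {v} vs c w v≢u with u ≟ v
  ... | yes u≡v = ⊥-elim (v≢u (sym u≡v))
  ... | no _ = refl

  forbidden : V → List V → List ℕ → List ℕ
  forbidden v vs w = map (λ u → colourOf u vs w) (conflicts v)

  Forbidden : V → List V → List ℕ → Set
  Forbidden v vs [] = ⊥
  Forbidden v vs (c ∷ w) = c ∈ forbidden v vs w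

  forbidden? : ∀ v vs → Decidable (Forbidden v vs)
  forbidden? v vs [] = no λ ()
  forbidden? v vs (c ∷ w) = DecMembership._∈?_ ℕ._≟_ c (forbidden v vs w)

  Admissible : V → List V → List ℕ → Set
  Admissible v vs z = ¬ Forbidden v vs z × ¬ HasSquarePrefix z

  admissible? : ∀ v vs → Decidable (Admissible v vs)
  admissible? v vs z = ¬? (forbidden? v vs z) ×-dec ¬? (hasSquarePrefix? ℕ._≟_ z)

  extensions : V → List (List ℕ) → List (List ℕ)
  extensions v = cartesianProductWith _∷_ (L v)

  -- Admissible words are built from the back: the new first letter avoids the colours of the
  -- later conflicts of v and creates no square prefix, which keeps the whole word square-free.
  colourings : List V → List (List ℕ)
  colourings [] = [ [] ]
  colourings (v ∷ vs) = filter (admissible? v vs) (extensions v (colourings vs))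

  ∈-colourings⁻ : ∀ {v vs z} → z ∈ colourings (v ∷ vs) →
    ∃[ c ] ∃[ w ] z ≡ c ∷ w × c ∈ L v × w ∈ colourings vs × Admissible v vs z
  ∈-colourings⁻ {v} {vs} z∈ with z∈E , adm ← ∈-filter⁻ (admissible? v vs) z∈
    with c , w , c∈L , w∈ , refl ← ∈-cartesianProductWith⁻ _∷_ (L v) (colourings vs) z∈E =
    c , w , refl , c∈L , w∈ , adm

  length-colouring : ∀ vs {w} → w ∈ colourings vs → length w ≡ length vs
  length-colouring [] (here refl) = refl
  length-colouring (v ∷ vs) w∈ with _ , _ , refl , _ , w′∈ , _ ← ∈-colourings⁻ w∈ =
    cong suc (length-colouring vs w′∈)

  colouring-drop : ∀ j vs {w} → w ∈ colourings vs → drop j w ∈ colourings (drop j vs)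
  colouring-drop zero vs w∈ = w∈
  colouring-drop (suc j) [] (here refl) = here refl
  colouring-drop (suc j) (v ∷ vs) w∈ with _ , _ , refl , _ , w′∈ , _ ← ∈-colourings⁻ w∈ =
    colouring-drop j vs w′∈

  colouring-squareFree : ∀ vs {w} → w ∈ colourings vs → SquareFree w
  colouring-squareFree [] (here refl) = squareFree-[]
  colouring-squareFree (v ∷ vs) w∈ with _ , _ , refl , _ , w′∈ , _ , ¬sq ← ∈-colourings⁻ w∈ =
    squareFree-∷ (colouring-squareFree vs w′∈) ¬sq

  colourOf-∈ : ∀ vs {v w} → v ∈ vs → w ∈ colourings vs → colourOf v vs w ∈ L v
  colourOf-∈ (q ∷ vs) {v} v∈ w∈ with _ , w′ , refl , c∈L , w′∈ , _ ← ∈-colourings⁻ w∈ | v ≟ q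
  ... | yes refl = c∈L
  ... | no v≢q with v∈
  ...   | here v≡q = ⊥-elim (v≢q v≡q)
  ...   | there v∈vs = colourOf-∈ vs v∈vs w′∈

  map-colourOf : ∀ vs {w} → Unique vs → w ∈ colourings vs → map (λ u → colourOf u vs w) vs ≡ w
  map-colourOf [] _ (here refl) = refl
  map-colourOf (v ∷ vs) (v≢vs ∷ vs-unique) w∈ with c , w′ , refl , _ , w′∈ , _ ← ∈-colourings⁻ w∈ =
    cong₂ _∷_ (colourOf-here v vs c w′) (begin
      map (λ u → colourOf u (v ∷ vs) (c ∷ w′)) vs ≡⟨ map-cong-local (All.map (colourOf-there vs c w′) v≢vs) ⟩
      map (λ u → colourOf u vs w′) vs             ≡⟨ map-colourOf vs vs-unique w′∈ ⟩
      w′                                          ∎)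
    where open ≡-Reasoning

  colouring-respects-conflicts : ∀ pre {v post u w} → Unique (pre ++ v ∷ post) → w ∈ colourings (pre ++ v ∷ post) →
    u ∈ post → u ∈ conflicts v → colourOf u (pre ++ v ∷ post) w ≢ colourOf v (pre ++ v ∷ post) w
  colouring-respects-conflicts [] {v} {post} {u} (v≢post ∷ _) w∈ u∈post u∈conf same
    with c , w′ , refl , _ , _ , (¬forbidden , _) ← ∈-colourings⁻ w∈ =
    ¬forbidden (subst (_∈ forbidden v post w′) colour≡ (∈-map⁺ (λ u → colourOf u post w′) u∈conf))
    where
    colour≡ : colourOf u post w′ ≡ c
    colour≡ = begin
      colourOf u post w′            ≡⟨ colourOf-there post c w′ (All.lookup v≢post u∈post) ⟨
      colourOf u (v ∷ post) (c ∷ w′) ≡⟨ same ⟩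
      colourOf v (v ∷ post) (c ∷ w′) ≡⟨ colourOf-here v post c w′ ⟩
      c                             ∎
      where open ≡-Reasoning
  colouring-respects-conflicts (p ∷ pre) {v} {post} {u} (p≢ ∷ unique) w∈ u∈post u∈conf same
    with c , w′ , refl , _ , w′∈ , _ ← ∈-colourings⁻ w∈ =
    colouring-respects-conflicts pre unique w′∈ u∈post u∈conf (begin
      colourOf u (pre ++ v ∷ post) w′            ≡⟨ colourOf-there _ c w′ (All.lookup p≢ (∈-++⁺ʳ pre (there u∈post))) ⟨
      colourOf u (p ∷ pre ++ v ∷ post) (c ∷ w′)  ≡⟨ same ⟩
      colourOf v (p ∷ pre ++ v ∷ post) (c ∷ w′)  ≡⟨ colourOf-there _ c w′ (All.lookup p≢ (∈-++⁺ʳ pre (here refl))) ⟩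
      colourOf v (pre ++ v ∷ post) w′            ∎)
    where open ≡-Reasoning

  candidates forbiddenCandidates squareCandidates : V → List V → List (List ℕ)
  candidates v vs = extensions v (colourings vs)
  forbiddenCandidates v vs = filter (forbidden? v vs) (candidates v vs)
  squareCandidates v vs = filter (hasSquarePrefix? ℕ._≟_) (candidates v vs)

  suffixCount : List V → ℕ
  suffixCount vs = sum (applyUpTo (λ j → length (colourings (drop j vs))) (suc (length vs)))

  module _ (L-unique : ∀ v → Unique (L v)) where

    extensions-unique : ∀ v {ws} → Unique ws → Unique (extensions v ws)
    extensions-unique v = Unique.cartesianProductWith⁺ _∷_ ∷-injective (L-unique v)

    colourings-unique : ∀ vs → Unique (colourings vs)
    colourings-unique [] = All.[] ∷ AllPairs.[]
    colourings-unique (v ∷ vs) =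
      Unique.filter⁺ (admissible? v vs) (extensions-unique v (colourings-unique vs))

    module _ (v : V) (vs : List V) where

      private
        candidates-unique : Unique (candidates v vs)
        candidates-unique = extensions-unique v (colourings-unique vs)

        ∈-candidates⁻ : ∀ {z} → z ∈ candidates v vs → ∃[ c ] ∃[ w ] w ∈ colourings vs × z ≡ c ∷ w
        ∈-candidates⁻ z∈ with c , w , _ , w∈ , z≡ ← ∈-cartesianProductWith⁻ _∷_ (L v) (colourings vs) z∈ =
          c , w , w∈ , z≡

      count-candidates : length (candidates v vs) ≤
        length (colourings (v ∷ vs)) + (length (forbiddenCandidates v vs) + length (squareCandidates v vs))
      count-candidates = begin
        length (candidates v vs)                                  ≤⟨ length-≤-⊆ candidates-unique split ⟩
        length (colourings (v ∷ vs) ++ forbiddenCandidates v vs ++ squareCandidates v vs)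
          ≡⟨ length-++ (colourings (v ∷ vs)) ⟩
        length (colourings (v ∷ vs)) + length (forbiddenCandidates v vs ++ squareCandidates v vs)
          ≡⟨ cong (length (colourings (v ∷ vs)) +_) (length-++ (forbiddenCandidates v vs)) ⟩
        length (colourings (v ∷ vs)) + (length (forbiddenCandidates v vs) + length (squareCandidates v vs)) ∎
        where
        open ≤-Reasoning
        split : ∀ {z} → z ∈ candidates v vs →
          z ∈ colourings (v ∷ vs) ++ forbiddenCandidates v vs ++ squareCandidates v vs
        split {z} z∈ with forbidden? v vs z | hasSquarePrefix? ℕ._≟_ z
        ... | yes forb | _ =
          ∈-++⁺ʳ (colourings (v ∷ vs)) (∈-++⁺ˡ (∈-filter⁺ (forbidden? v vs) z∈ forb))
        ... | no _ | yes sq =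
          ∈-++⁺ʳ (colourings (v ∷ vs))
            (∈-++⁺ʳ (forbiddenCandidates v vs) (∈-filter⁺ (hasSquarePrefix? ℕ._≟_) z∈ sq))
        ... | no ¬forb | no ¬sq = ∈-++⁺ˡ (∈-filter⁺ (admissible? v vs) z∈ (¬forb , ¬sq))

      count-forbidden : length (forbiddenCandidates v vs) ≤ length (colourings vs) * length (conflicts v)
      count-forbidden = begin
        length (forbiddenCandidates v vs)
          ≤⟨ length-≤-⊆ (Unique.filter⁺ (forbidden? v vs) candidates-unique) ⊆T ⟩
        length T
          ≡⟨ length-cartesianProductWith forbiddenExtension (colourings vs) (conflicts v) ⟩
        length (colourings vs) * length (conflicts v) ∎
        where
        open ≤-Reasoning
        forbiddenExtension : List ℕ → V → List ℕ
        forbiddenExtension w u = colourOf u vs w ∷ w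
        T = cartesianProductWith forbiddenExtension (colourings vs) (conflicts v)
        ⊆T : ∀ {z} → z ∈ forbiddenCandidates v vs → z ∈ T
        ⊆T z∈ with z∈C , forb ← ∈-filter⁻ (forbidden? v vs) z∈
          with c , w , w∈ , refl ← ∈-candidates⁻ z∈C
          with u , u∈conf , refl ← ∈-map⁻ (λ u → colourOf u vs w) forb =
          ∈-cartesianProductWith⁺ forbiddenExtension w∈ u∈conf

      count-squarePrefix : ∀ j →
        length (filter (squarePrefix? ℕ._≟_ (suc j)) (candidates v vs)) ≤ length (colourings (drop j vs))
      count-squarePrefix j = length-≤-injection (drop (suc j)) (Unique.filter⁺ SP? candidates-unique) injective into
        where
        SP? = squarePrefix? ℕ._≟_ (suc j)
        SP⇒≡ : ∀ {z} → z ∈ filter SP? (candidates v vs) → z ≡ take (suc j) (drop (suc j) z) ++ drop (suc j) z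
        SP⇒≡ {z} z∈ = SquarePrefix⇒≡ (suc j) z (proj₂ (∈-filter⁻ SP? {xs = candidates v vs} z∈))
        injective : ∀ {x y} → x ∈ filter SP? (candidates v vs) → y ∈ filter SP? (candidates v vs) →
          drop (suc j) x ≡ drop (suc j) y → x ≡ y
        injective {x} {y} x∈ y∈ drop≡ = begin
          x                                                   ≡⟨ SP⇒≡ x∈ ⟩
          take (suc j) (drop (suc j) x) ++ drop (suc j) x     ≡⟨ cong (λ t → take (suc j) t ++ t) drop≡ ⟩
          take (suc j) (drop (suc j) y) ++ drop (suc j) y     ≡⟨ SP⇒≡ y∈ ⟨
          y                                                   ∎
          where open ≡-Reasoning
        into : ∀ {z} → z ∈ filter SP? (candidates v vs) → drop (suc j) z ∈ colourings (drop j vs)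
        into z∈ with _ , w , w∈ , refl ← ∈-candidates⁻ (proj₁ (∈-filter⁻ SP? z∈)) = colouring-drop j vs w∈

      count-squares : length (squareCandidates v vs) ≤ suffixCount vs
      count-squares = begin
        length (squareCandidates v vs)
          ≤⟨ length-≤-⊆ (Unique.filter⁺ (hasSquarePrefix? ℕ._≟_) candidates-unique) ⊆concat ⟩
        length (concat (applyUpTo byHalfLength K))    ≡⟨ length-concat (applyUpTo byHalfLength K) ⟩
        sum (map length (applyUpTo byHalfLength K))   ≡⟨ cong sum (map-applyUpTo byHalfLength length K) ⟩
        sum (applyUpTo (length ∘ byHalfLength) K)     ≤⟨ sum-applyUpTo-mono count-squarePrefix K ⟩
        suffixCount vs                                ∎
        where
        open ≤-Reasoning
        K = suc (length vs)
        byHalfLength : ℕ → List (List ℕ)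
        byHalfLength j = filter (squarePrefix? ℕ._≟_ (suc j)) (candidates v vs)
        ⊆concat : ∀ {z} → z ∈ squareCandidates v vs → z ∈ concat (applyUpTo byHalfLength K)
        ⊆concat z∈ with z∈C , (j , j< , sp) ← ∈-filter⁻ (hasSquarePrefix? ℕ._≟_) z∈
          with _ , w , w∈ , refl ← ∈-candidates⁻ z∈C =
          ∈-concat⁺′ (∈-filter⁺ (squarePrefix? ℕ._≟_ (suc j)) z∈C sp)
            (∈-applyUpTo⁺ byHalfLength (subst (j <_) (cong suc (length-colouring vs w∈)) j<))

    module _ (k : ℕ) (L-length : ∀ v → k + 4 ≤ length (L v)) (conflicts-length : ∀ v → length (conflicts v) ≤ k)
      where

      colourings-doubling : ∀ v vs → suffixCount vs ≤ 2 * length (colourings vs) →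
        2 * length (colourings vs) ≤ length (colourings (v ∷ vs))
      colourings-doubling v vs count≤ = +-cancelʳ-≤ (n * k + 2 * n) (2 * n) s (begin
        2 * n + (n * k + 2 * n)                   ≡⟨ arithmetic k n ⟩
        (k + 4) * n                               ≤⟨ *-monoˡ-≤ n (L-length v) ⟩
        length (L v) * n                          ≡⟨ length-cartesianProductWith _∷_ (L v) (colourings vs) ⟨
        length (candidates v vs)                  ≤⟨ count-candidates v vs ⟩
        s + (length (forbiddenCandidates v vs) + length (squareCandidates v vs))
          ≤⟨ +-monoʳ-≤ s (+-mono-≤ (≤-trans (count-forbidden v vs) (*-monoʳ-≤ n (conflicts-length v)))
                                   (≤-trans (count-squares v vs) count≤)) ⟩
        s + (n * k + 2 * n)                       ∎)
        where
        open ≤-Reasoning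
        n = length (colourings vs)
        s = length (colourings (v ∷ vs))
        arithmetic : ∀ k n → 2 * n + (n * k + 2 * n) ≡ (k + 4) * n
        arithmetic = solve-∀

      colourings-grow : ∀ vs → 1 ≤ length (colourings vs) × suffixCount vs ≤ 2 * length (colourings vs)
      colourings-grow [] = ≤-refl , s≤s z≤n
      colourings-grow (v ∷ vs) with 1≤n , count≤ ← colourings-grow vs =
        ≤-trans 1≤n (≤-trans (m≤m+n n (n + 0)) doubled) ,
        +-monoʳ-≤ s (≤-trans count≤ (≤-trans doubled (m≤m+n s 0)))
        where
        n = length (colourings vs)
        s = length (colourings (v ∷ vs))
        doubled = colourings-doubling v vs count≤

  record SquareFreeColouring (Q : List V) : Set where
    field
      colour : V → ℕ
      colour∈L : ∀ {v} → v ∈ Q → colour v ∈ L v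
      squareFree : SquareFree (map colour Q)
      respects-conflicts : ∀ pre {v post u} → Q ≡ pre ++ v ∷ post → u ∈ post → u ∈ conflicts v →
        colour u ≢ colour v

  squareFree-list-colouring : ∀ k → (∀ v → Unique (L v)) → (∀ v → k + 4 ≤ length (L v)) →
    (∀ v → length (conflicts v) ≤ k) → ∀ Q → Unique Q → SquareFreeColouring Q
  squareFree-list-colouring k L-unique L-length conflicts-length Q Q-unique = record
    { colour = λ v → colourOf v Q w
    ; colour∈L = λ v∈ → colourOf-∈ Q v∈ w∈
    ; squareFree = subst SquareFree (sym (map-colourOf Q Q-unique w∈)) (colouring-squareFree Q w∈)
    ; respects-conflicts = λ { pre refl → colouring-respects-conflicts pre Q-unique w∈ }
    }
    where
    w = lookup (colourings Q) (fromℕ< (proj₁ (colourings-grow L-unique k L-length conflicts-length Q)))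
    w∈ : w ∈ colourings Q
    w∈ = ∈-lookup _

-- The apic graph

module _ {A : Set} where

  Consecutive : A → A → List A → Set
  Consecutive a b xs = ∃[ pre ] ∃[ post ] xs ≡ pre ++ a ∷ b ∷ post

  Consecutive-tabulate : ∀ {n} (f : Fin (suc n) → A) i → Consecutive (f (inject₁ i)) (f (fsuc i)) (tabulate f)
  Consecutive-tabulate {suc n} f fzero = [] , tabulate (f ∘ fsuc ∘ fsuc) , refl
  Consecutive-tabulate {suc n} f (fsuc i) with pre , post , eq ← Consecutive-tabulate (f ∘ fsuc) i =
    f fzero ∷ pre , post , cong (f fzero ∷_) eq

  Consecutive-++ʳ : ∀ {a b xs} ys → Consecutive a b xs → Consecutive a b (xs ++ ys)
  Consecutive-++ʳ ys (pre , post , refl) = pre , post ++ ys , ++-assoc pre _ ys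

  Consecutive-++ˡ : ∀ {a b ys} xs → Consecutive a b ys → Consecutive a b (xs ++ ys)
  Consecutive-++ˡ xs (pre , post , refl) = xs ++ pre , post , sym (++-assoc xs pre _)

  Consecutive-reverse : ∀ {a b xs} → Consecutive a b xs → Consecutive b a (reverse xs)
  Consecutive-reverse {a} {b} (pre , post , refl) = reverse post , reverse pre , (begin
    reverse (pre ++ a ∷ b ∷ post)                ≡⟨ reverse-++ pre (a ∷ b ∷ post) ⟩
    reverse (a ∷ b ∷ post) ++ reverse pre        ≡⟨ cong (_++ reverse pre) (unfold-reverse a (b ∷ post)) ⟩
    (reverse (b ∷ post) ++ [ a ]) ++ reverse pre ≡⟨ cong (λ t → (t ++ [ a ]) ++ reverse pre) (unfold-reverse b post) ⟩
    ((reverse post ++ [ b ]) ++ [ a ]) ++ reverse pre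
      ≡⟨ ++-assoc (reverse post ++ [ b ]) [ a ] (reverse pre) ⟩
    (reverse post ++ [ b ]) ++ a ∷ reverse pre   ≡⟨ ++-assoc (reverse post) [ b ] (a ∷ reverse pre) ⟩
    reverse post ++ b ∷ a ∷ reverse pre          ∎)
    where open ≡-Reasoning

  precedes-++ : ∀ {a b} (xs : List A) {ys} → a ∈ xs → b ∈ ys →
    ∃[ pre ] ∃[ post ] xs ++ ys ≡ pre ++ a ∷ post × b ∈ post
  precedes-++ xs {ys} a∈ b∈ with pre , post , refl ← ∈-∃++ a∈ =
    pre , post ++ ys , ++-assoc pre _ ys , ∈-++⁺ʳ post b∈

  Consecutive-cycle⇒≢ : ∀ {c W a b} → c ∉ W → SquareFree W → Consecutive a b (c ∷ W) → a ≢ b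
  Consecutive-cycle⇒≢ c∉W sf ([] , post , refl) refl = c∉W (here refl)
  Consecutive-cycle⇒≢ c∉W sf (_ ∷ pre , post , eq) = squareFree⇒≢ pre post sf (∷-injectiveʳ eq)

module _ {A B : Set} (f : A → B) where

  Consecutive-map : ∀ {a b xs} → Consecutive a b xs → Consecutive (f a) (f b) (map f xs)
  Consecutive-map {a} {b} (pre , post , refl) = map f pre , map f post , map-++ f pre (a ∷ b ∷ post)

left right : ∀ {n} → Fin (suc n) → List (Fin (suc n))
left fzero = []
left (fsuc i) = [ inject₁ i ]
right {zero} fzero = []
right {suc n} fzero = [ fsuc fzero ]
right {suc n} (fsuc i) = map fsuc (right i)

length-left : ∀ {n} (i : Fin (suc n)) → length (left i) ≤ 1
length-left fzero = z≤n
length-left (fsuc i) = s≤s z≤n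

length-right : ∀ {n} (i : Fin (suc n)) → length (right i) ≤ 1
length-right {zero} fzero = z≤n
length-right {suc n} fzero = s≤s z≤n
length-right {suc n} (fsuc i) = subst (_≤ 1) (sym (length-map fsuc (right i))) (length-right i)

∈-right : ∀ {n} (i : Fin n) → fsuc i ∈ right (inject₁ i)
∈-right {suc n} fzero = here refl
∈-right {suc n} (fsuc i) = ∈-map⁺ fsuc (∈-right i)

-- the bottom vertices that any choice of diagonals can make adjacent to a top vertex
below : ∀ {m} → V m → List (V m)
below (false , i) = bot i ∷ map bot (left i ++ right i)
below (true , _) = []

right∈below : ∀ {m} (i : Fin m) → bot (fsuc i) ∈ below (top (inject₁ i))
right∈below i = there (∈-map⁺ bot (∈-++⁺ʳ (left (inject₁ i)) (∈-right i)))

length-below : ∀ {m} (v : V m) → length (below v) ≤ 3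
length-below (true , _) = z≤n
length-below (false , i) = s≤s (begin
  length (map bot (left i ++ right i))   ≡⟨ length-map bot (left i ++ right i) ⟩
  length (left i ++ right i)             ≡⟨ length-++ (left i) ⟩
  length (left i) + length (right i)     ≤⟨ +-mono-≤ (length-left i) (length-right i) ⟩
  2                                      ∎)
  where open ℕ.≤-Reasoning

outerPath : ∀ m → List (V m)
outerPath m = map top (tabulate {n = m} fsuc) ++ reverse (map bot (allFin (suc m)))

module _ {m : ℕ} where

  outerFace-unique : Unique (outerFace m)
  outerFace-unique = Unique.++⁺ (Unique.map⁺ (cong proj₂) (Unique.allFin⁺ (suc m)))
    (Unique-resp-↭ (↭-sym (↭-reverse _)) (Unique.map⁺ (cong proj₂) (Unique.allFin⁺ (suc m))))
    top≢bot
    where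
    top≢bot : ∀ {v} → ¬ (v ∈ map top (allFin (suc m)) × v ∈ reverse (map bot (allFin (suc m))))
    top≢bot (v∈tops , v∈bots) with _ , _ , refl ← ∈-map⁻ top v∈tops
      with _ , _ , () ← ∈-map⁻ bot (reverse⁻ {xs = map bot (allFin (suc m))} v∈bots)

  ∈-outerFace : ∀ v → v ∈ outerFace m
  ∈-outerFace (false , i) = ∈-++⁺ˡ (∈-map⁺ top (∈-allFin i))
  ∈-outerFace (true , i) = ∈-++⁺ʳ (map top (allFin (suc m))) (reverse⁺ (∈-map⁺ bot (∈-allFin i)))

  top-top-consecutive : ∀ (i : Fin m) → Consecutive (top (inject₁ i)) (top (fsuc i)) (outerFace m)
  top-top-consecutive i = Consecutive-++ʳ _ (Consecutive-map top (Consecutive-tabulate (λ j → j) i))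

  bot-bot-consecutive : ∀ (i : Fin m) → Consecutive (bot (fsuc i)) (bot (inject₁ i)) (outerFace m)
  bot-bot-consecutive i = Consecutive-++ˡ (map top (allFin (suc m)))
    (Consecutive-reverse (Consecutive-map bot (Consecutive-tabulate (λ j → j) i)))

  outerPath-precedes : ∀ (t : Fin m) s → ∃[ pre ] ∃[ post ] outerPath m ≡ pre ++ top (fsuc t) ∷ post × bot s ∈ post
  outerPath-precedes t s =
    precedes-++ (map top (tabulate fsuc)) (∈-map⁺ top (∈-tabulate⁺ t)) (reverse⁺ (∈-map⁺ bot (∈-allFin s)))

  ∈-outerPath : ∀ {v} → v ≢ top fzero → v ∈ outerPath m
  ∈-outerPath {v} v≢x with ∈-outerFace v
  ... | here v≡x = ⊥-elim (v≢x v≡x)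
  ... | there v∈ = v∈

Unique-triangle : ∀ {A : Set} {a b e : A} → a ≢ b → a ≢ e → b ≢ e → Unique (a ∷ b ∷ e ∷ [])
Unique-triangle a≢b a≢e b≢e = (a≢b All.∷ a≢e All.∷ All.[]) ∷ (b≢e All.∷ All.[]) ∷ All.[] ∷ AllPairs.[]

module ApicColouring {m : ℕ} (L : V m → List ℕ)
  (L-unique : ∀ v → Unique (L v)) (L-length : ∀ v → 8 ≤ length (L v)) where

  x : V m
  x = top fzero

  c : ℕ
  c = lookup (L x) (fromℕ< (≤-trans (s≤s z≤n) (L-length x)))

  ≢c? : Decidable (_≢ c)
  ≢c? y = ¬? (y ℕ.≟ c)

  L′ : V m → List ℕ
  L′ v = filter ≢c? (L v)

  L′-length : ∀ v → 3 + 4 ≤ length (L′ v)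
  L′-length v = +-cancelʳ-≤ 1 7 (length (L′ v)) (begin
    8                          ≤⟨ L-length v ⟩
    length (L v)               ≤⟨ length-≤-⊆ (L-unique v) split ⟩
    length (L′ v ++ [ c ])     ≡⟨ length-++ (L′ v) ⟩
    length (L′ v) + 1          ∎)
    where
    open ℕ.≤-Reasoning
    split : ∀ {y} → y ∈ L v → y ∈ L′ v ++ [ c ]
    split {y} y∈ with y ℕ.≟ c
    ... | yes y≡c = ∈-++⁺ʳ (L′ v) (here y≡c)
    ... | no y≢c = ∈-++⁺ˡ (∈-filter⁺ ≢c? y∈ y≢c)

  open ConstrainedListColouring _≟V_ L′ below
  open SquareFreeColouring (squareFree-list-colouring 3 (Unique.filter⁺ ≢c? ∘ L-unique) L′-length length-below
    (outerPath m) (AllPairs.tail outerFace-unique)) renaming (colour to φ′)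

  φ : V m → ℕ
  φ (false , fzero) = c
  φ v = φ′ v

  φ-other : ∀ {v} → v ≢ x → φ v ≡ φ′ v
  φ-other {false , fzero} v≢x = ⊥-elim (v≢x refl)
  φ-other {false , fsuc _} _ = refl
  φ-other {true , _} _ = refl

  φ-other-valid : ∀ {v} → v ≢ x → φ v ∈ L v × φ v ≢ c
  φ-other-valid {v} v≢x = ∈-filter⁻ ≢c? {xs = L v} (subst (_∈ L′ v) (sym (φ-other v≢x)) (colour∈L (∈-outerPath v≢x)))

  φ∈L : ∀ v → φ v ∈ L v
  φ∈L (false , fzero) = ∈-lookup _
  φ∈L v@(false , fsuc _) = proj₁ (φ-other-valid {v} (λ ()))
  φ∈L v@(true , _) = proj₁ (φ-other-valid {v} (λ ()))

  ∈-outerPath⇒≢x : ∀ {v} → v ∈ outerPath m → v ≢ x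
  ∈-outerPath⇒≢x v∈ refl = Unique.Unique[x∷xs]⇒x∉xs outerFace-unique v∈

  W : List ℕ
  W = map φ (outerPath m)

  W-squareFree : SquareFree W
  W-squareFree = subst SquareFree (sym (map-cong-local (All.tabulate (φ-other ∘ ∈-outerPath⇒≢x)))) squareFree

  c∉W : c ∉ W
  c∉W c∈W with v , v∈ , c≡ ← ∈-map⁻ φ c∈W = proj₂ (φ-other-valid (∈-outerPath⇒≢x v∈)) (sym c≡)

  φ-consecutive : ∀ {a b} → Consecutive a b (outerFace m) → φ a ≢ φ b
  φ-consecutive cons = Consecutive-cycle⇒≢ c∉W W-squareFree (Consecutive-map φ cons)

  φ-top-top : ∀ (i : Fin m) → φ (top (inject₁ i)) ≢ φ (top (fsuc i))
  φ-top-top i = φ-consecutive (top-top-consecutive i)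

  φ-bot-bot : ∀ (i : Fin m) → φ (bot (fsuc i)) ≢ φ (bot (inject₁ i))
  φ-bot-bot i = φ-consecutive (bot-bot-consecutive i)

  φ-below : ∀ {t s} → bot s ∈ below (top t) → φ (top t) ≢ φ (bot s)
  φ-below {fzero} {s} _ same = proj₂ (φ-other-valid {bot s} (λ ())) (sym same)
  φ-below {fsuc t} {s} s∈ same with pre , post , eq , s∈post ← outerPath-precedes t s =
    respects-conflicts pre eq s∈post s∈ (begin
      φ′ (bot s)       ≡⟨ φ-other {bot s} (λ ()) ⟨
      φ (bot s)        ≡⟨ same ⟨
      φ (top (fsuc t)) ≡⟨ φ-other {top (fsuc t)} (λ ()) ⟩
      φ′ (top (fsuc t)) ∎)
    where open ≡-Reasoning

  triangle-injective : ∀ d (i : Fin m) {F} → F ∈ triangles d i → Unique (map φ F)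
  triangle-injective d i F∈ with d i | F∈
  ... | true | here refl = Unique-triangle (φ-top-top i) (φ-below (here refl)) (φ-below (there (here refl)))
  ... | true | there (here refl) = Unique-triangle (φ-below (here refl)) (φ-below (there (here refl))) (φ-bot-bot i)
  ... | false | here refl = Unique-triangle (φ-top-top i) (φ-below (right∈below i)) (φ-below (here refl))
  ... | false | there (here refl) = Unique-triangle (φ-below (right∈below i)) (φ-below (here refl)) (φ-bot-bot i)

  φ-facialNonRepetitive : ∀ d → FacialNonRepetitive d φ
  φ-facialNonRepetitive d _ (_ , here refl , r , inj₁ refl , s , _ , l , _ , _ , refl) =
    subst (¬_ ∘ IsRepetition) (sym (map-rotate φ l s r)) (cycle-nonRepetitive c∉W W-squareFree s l)
  φ-facialNonRepetitive d _ (_ , here refl , r , inj₂ refl , s , s< , l , _ , _ , refl) =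
    subst (¬_ ∘ IsRepetition) (sym (trans (map-rotate φ l s r) (cong (take l ∘ rotate s) (reverse-map φ (outerFace m)))))
      (reverse-cycle-nonRepetitive c∉W W-squareFree s l s≤)
    where
    s≤ : s ≤ length W
    s≤ = subst (s ≤_) (sym (length-map φ (outerPath m))) (s≤s⁻¹ s<)
  φ-facialNonRepetitive d _ (F , there F∈ , r , r≡ , s , _ , l , _ , _ , refl)
    with i , _ , F∈i ← find (∈-concatMap⁻ (triangles d) {xs = allFin m} F∈) =
    Unique⇒facialWalk-nonRepetitive φ (triangle-injective d i F∈i) r≡ s l

theorem12 : (m : ℕ) → 2 ≤ m → (d : Diagonals m) → IsApic d →
    (L : V m → List ℕ) → (∀ v → Unique (L v) × 8 ≤ length (L v)) →
    ∃[ φ ] ((∀ v → φ v ∈ L v) × FacialNonRepetitive d φ)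
theorem12 m _ d _ L L-valid = φ , φ∈L , φ-facialNonRepetitive d
  where open ApicColouring L (proj₁ ∘ L-valid) (proj₂ ∘ L-valid)
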